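{- Let $\theta>0$, let $n\ge 1$ be an integer, and let $\tau$ be a sequence of $k\le n$ distinct integers of $[n]=\{1,\dots,n\}$. Let $M$ be the largest element of $[n]$ that does not appear in $\tau$ (with $M=0$ if every element of $[n]$ appears in $\tau$), let $m$ be the number of records of $\tau$ whose value is larger than $M$, and set $w'_n(\tau)=\theta^{m}$. Then for every permutation $\sigma\in\mathfrak{S}_n$ which, viewed as a word, factors as a concatenation $\sigma=\pi\cdot\tau$ (so $\pi$ is the word formed by the first $n-k$ letters of $\sigma$), we have $w(\sigma)=w(\pi)\cdot w'_n(\tau)$.
   Context: $\mathfrak{S}_n$ is the set of permutations of $[n]$; a permutation $\sigma$ is identified with the word $\sigma(1)\sigma(2)\cdots\sigma(n)$. For a finite sequence $s=s_1\cdots s_\ell$ of distinct integers, $s_i$ is a record (and there is a record at position $i$) if $s_i>s_j$ for all $j<i$. $\mathrm{rec}(s)$ denotes the number of records of $s$, and the weight of $s$ is $w(s)=\theta^{\mathrm{rec}(s)}$ (the empty sequence has weight $1$). The symbol $\cdot$ denotes concatenation of words. -}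

module Defs where

open import Data.Nat using (ℕ; zero; suc; _<ᵇ_)
open import Data.Bool using (Bool; true; false; if_then_else_)
open import Data.List using (List; []; _∷_; length; filter; map; upTo)
open import Data.List.Membership.DecPropositional (Data.Nat._≟_) using (_∈?_)
open import Relation.Nullary using (does)
import Data.Nat as N

[_] : ℕ → List ℕ
[ n ] = map suc (upTo n)

allᵇ : (ℕ → Bool) → List ℕ → Bool
allᵇ f [] = true
allᵇ f (y ∷ ys) = if f y then allᵇ f ys else false

-- record values of a word; first argument = the (reversed) prefix read so far.
-- x is a record iff x > y for every earlier letter y.
recordsFrom : List ℕ → List ℕ → List ℕ
recordsFrom p [] = []
recordsFrom p (x ∷ xs) =
  if allᵇ (λ y → y <ᵇ x) p
  then x ∷ recordsFrom (x ∷ p) xs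
  else recordsFrom (x ∷ p) xs

records : List ℕ → List ℕ
records s = recordsFrom [] s

rec : List ℕ → ℕ
rec s = length (records s)

maxMissing : ℕ → List ℕ → ℕ
maxMissing zero τ = zero
maxMissing (suc k) τ = if does (suc k ∈? τ) then maxMissing k τ else suc k

bigM : ℕ → List ℕ → ℕ
bigM n τ = maxMissing n τ

recAbove : ℕ → List ℕ → ℕ
recAbove n τ = length (filter (λ x → bigM n τ N.<? x) (records τ))

-- Reading σ = π · τ from the left, the records of σ are the
-- records of π followed by those letters of τ that are records of τ and
-- moreover exceed every letter of π. Since σ is a permutation of [n], the
-- letters of π are exactly the elements of [n] missing from τ, whose maximum
-- is M; so a record x of τ exceeds all of π iff x > M, and
-- rec σ = rec π + m.

module Submission where

open import Defs
open import Level using (Level)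
open import Data.Nat using (ℕ; zero; suc; _≤_; _<_; _<ᵇ_; _<?_; _+_; z≤n; s≤s)
open import Data.Nat.Properties
  using (≤-refl; ≤-<-trans; m≤n⇒m≤1+n; m≤n⇒m<n∨m≡n; ≤-pred; <⇒≱; suc-injective)
open import Data.Bool using (true; false; _∧_)
open import Data.Product using (_×_; _,_; proj₁)
open import Data.Sum using (inj₁; inj₂)
open import Data.Empty using (⊥-elim)
open import Data.List using (List; []; _∷_; _++_; _ʳ++_; reverse; length; filter)
open import Data.List.Properties using (length-++)
open import Data.List.Relation.Unary.All as All using (All; []; _∷_)
import Data.List.Relation.Unary.Any.Properties as Any
open import Data.List.Relation.Unary.Unique.Propositional using (Unique; _∷_)
import Data.List.Relation.Unary.Unique.Propositional.Properties as Unique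
open import Data.List.Relation.Binary.Permutation.Propositional using (_↭_; ↭-sym; ↭⇒↭ₛ)
open import Data.List.Relation.Binary.Permutation.Propositional.Properties using (∈-resp-↭)
open import Data.List.Relation.Binary.Permutation.Setoid.Properties
  using (Unique-resp-↭)
open import Data.List.Membership.Propositional using (_∈_; _∉_)
open import Data.List.Membership.Propositional.Properties
  using (∈-map⁺; ∈-map⁻; ∈-upTo⁺; ∈-upTo⁻; ∈-++⁺ˡ; ∈-++⁺ʳ; ∈-++⁻)
open import Data.List.Membership.DecPropositional (Data.Nat._≟_) using (_∈?_)
open import Data.List.Relation.Unary.Any using (here; there)
open import Function.Bundles using (_⇔_; mk⇔; Equivalence)
open import Relation.Unary using (Pred; Decidable)
open import Relation.Nullary using (does; yes; no)
open import Relation.Nullary.Decidable using (does-⇔)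
open import Relation.Binary.PropositionalEquality
  using (_≡_; refl; cong; setoid; module ≡-Reasoning)
open import Algebra.Bundles using (CommutativeSemiring)
import Algebra.Definitions.RawSemiring as RS
open import Algebra.Properties.Semiring.Exp using (^-homo-*)

allᵇ-++ : ∀ f xs ys → allᵇ f (xs ++ ys) ≡ allᵇ f xs ∧ allᵇ f ys
allᵇ-++ f [] ys = refl
allᵇ-++ f (y ∷ xs) ys with f y
... | true = allᵇ-++ f xs ys
... | false = refl

allᵇ-<ᵇ : ∀ x xs → allᵇ (_<ᵇ x) xs ≡ does (All.all? (_<? x) xs)
allᵇ-<ᵇ x [] = refl
allᵇ-<ᵇ x (y ∷ xs) with y <ᵇ x
... | true = allᵇ-<ᵇ x xs
... | false = refl

recordsFrom-++ : ∀ p xs ys →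
  recordsFrom p (xs ++ ys) ≡ recordsFrom p xs ++ recordsFrom (xs ʳ++ p) ys
recordsFrom-++ p [] ys = refl
recordsFrom-++ p (x ∷ xs) ys with allᵇ (_<ᵇ x) p
... | true = cong (x ∷_) (recordsFrom-++ (x ∷ p) xs ys)
... | false = recordsFrom-++ (x ∷ p) xs ys

-- The prefix is stored reversed, so the letters ctx read before the letters q
-- sit at the end of q ++ ctx; they can only discard records.
recordsFrom-++-filter : ∀ {ℓ} {P : Pred ℕ ℓ} (P? : Decidable P) q ctx ys →
  All (λ x → All (_< x) ctx ⇔ P x) ys →
  recordsFrom (q ++ ctx) ys ≡ filter P? (recordsFrom q ys)
recordsFrom-++-filter P? q ctx [] [] = refl
recordsFrom-++-filter P? q ctx (x ∷ ys) (ctx<x⇔Px ∷ h)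
  rewrite allᵇ-++ (_<ᵇ x) q ctx with allᵇ (_<ᵇ x) q
... | false = recordsFrom-++-filter P? (x ∷ q) ctx ys h
... | true rewrite allᵇ-<ᵇ x ctx | does-⇔ ctx<x⇔Px (All.all? (_<? x) ctx) (P? x)
  with does (P? x)
...   | true = cong (x ∷_) (recordsFrom-++-filter P? (x ∷ q) ctx ys h)
...   | false = recordsFrom-++-filter P? (x ∷ q) ctx ys h

∈-[]⁺ : ∀ {n y} → 1 ≤ y → y ≤ n → y ∈ [ n ]
∈-[]⁺ {y = suc y} _ y<n = ∈-map⁺ suc (∈-upTo⁺ y<n)

∈-[]⁻ : ∀ {n y} → y ∈ [ n ] → 1 ≤ y × y ≤ n
∈-[]⁻ y∈[n] with ∈-map⁻ suc y∈[n]
... | _ , x∈upTo , refl = s≤s z≤n , ∈-upTo⁻ x∈upTo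

[]-unique : ∀ n → Unique [ n ]
[]-unique n = Unique.map⁺ suc-injective (Unique.upTo⁺ n)

maxMissing-maximal : ∀ k τ {y} → 1 ≤ y → y ≤ k → y ∉ τ → y ≤ maxMissing k τ
maxMissing-maximal zero τ 1≤y y≤0 _ = ⊥-elim (<⇒≱ 1≤y y≤0)
maxMissing-maximal (suc k) τ 1≤y y≤1+k y∉τ with suc k ∈? τ
... | no _ = y≤1+k
... | yes 1+k∈τ with m≤n⇒m<n∨m≡n y≤1+k
...   | inj₁ y<1+k = maxMissing-maximal k τ 1≤y (≤-pred y<1+k) y∉τ
...   | inj₂ refl = ⊥-elim (y∉τ 1+k∈τ)

maxMissing-missing : ∀ k τ → 1 ≤ maxMissing k τ →
  maxMissing k τ ≤ k × maxMissing k τ ∉ τ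
maxMissing-missing (suc k) τ 1≤M with suc k ∈? τ
... | no 1+k∉τ = ≤-refl , 1+k∉τ
... | yes _ with maxMissing-missing k τ 1≤M
...   | M≤k , M∉τ = m≤n⇒m≤1+n M≤k , M∉τ

maxMissing-<⇔ : ∀ n τ ctx → (∀ {y} → y ∈ ctx ⇔ (y ∈ [ n ] × y ∉ τ)) →
  ∀ {x} → 1 ≤ x → All (_< x) ctx ⇔ maxMissing n τ < x
maxMissing-<⇔ n τ ctx ctx≡[n]∖τ {x} 1≤x = mk⇔ below above
  where
  M = maxMissing n τ

  below : All (_< x) ctx → M < x
  below ctx<x with M | maxMissing-missing n τ
  ... | zero | _ = 1≤x
  ... | suc _ | missing with missing (s≤s z≤n)
  ...   | M≤n , M∉τ =
    All.lookup ctx<x (Equivalence.from ctx≡[n]∖τ (∈-[]⁺ (s≤s z≤n) M≤n , M∉τ))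

  above : M < x → All (_< x) ctx
  above M<x = All.tabulate λ y∈ctx →
    let y∈[n] , y∉τ = Equivalence.to ctx≡[n]∖τ y∈ctx
        1≤y , y≤n = ∈-[]⁻ y∈[n]
    in ≤-<-trans (maxMissing-maximal n τ 1≤y y≤n y∉τ) M<x

Unique-++⇒∉ : ∀ {A : Set} (xs ys : List A) {y} → Unique (xs ++ ys) → y ∈ xs → y ∉ ys
Unique-++⇒∉ (x ∷ xs) ys (x∉ ∷ _) (here refl) y∈ys = All.lookup x∉ (∈-++⁺ʳ xs y∈ys) refl
Unique-++⇒∉ (x ∷ xs) ys (_ ∷ u) (there y∈xs) = Unique-++⇒∉ xs ys u y∈xs

prefix-complement : ∀ n π τ → (π ++ τ) ↭ [ n ] →
  ∀ {y} → y ∈ reverse π ⇔ (y ∈ [ n ] × y ∉ τ)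
prefix-complement n π τ π·τ↭[n] = mk⇔ to from
  where
  π·τ-unique : Unique (π ++ τ)
  π·τ-unique = Unique-resp-↭ (setoid ℕ) (↭⇒↭ₛ (↭-sym π·τ↭[n])) ([]-unique n)

  to : ∀ {y} → y ∈ reverse π → y ∈ [ n ] × y ∉ τ
  to y∈πʳ = let y∈π = Any.reverse⁻ y∈πʳ in
    ∈-resp-↭ π·τ↭[n] (∈-++⁺ˡ y∈π) , Unique-++⇒∉ π τ π·τ-unique y∈π

  from : ∀ {y} → y ∈ [ n ] × y ∉ τ → y ∈ reverse π
  from (y∈[n] , y∉τ) with ∈-++⁻ π (∈-resp-↭ (↭-sym π·τ↭[n]) y∈[n])
  ... | inj₁ y∈π = Any.reverse⁺ y∈π
  ... | inj₂ y∈τ = ⊥-elim (y∉τ y∈τ)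

rec-++-complement : ∀ n π τ → All (λ x → 1 ≤ x × x ≤ n) τ → (π ++ τ) ↭ [ n ] →
  rec (π ++ τ) ≡ rec π + recAbove n τ
rec-++-complement n π τ τ⊆[n] π·τ↭[n] = begin
  length (records (π ++ τ))
    ≡⟨ cong length (recordsFrom-++ [] π τ) ⟩
  length (records π ++ recordsFrom (reverse π) τ)
    ≡⟨ length-++ (records π) ⟩
  rec π + length (recordsFrom (reverse π) τ)
    ≡⟨ cong (λ rs → rec π + length rs)
         (recordsFrom-++-filter (bigM n τ <?_) [] (reverse π) τ (All.map above-M⇔ τ⊆[n])) ⟩
  rec π + recAbove n τ ∎
  where
  open ≡-Reasoning
  above-M⇔ : ∀ {x} → 1 ≤ x × x ≤ n → All (_< x) (reverse π) ⇔ bigM n τ < x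
  above-M⇔ (1≤x , _) = maxMissing-<⇔ n τ (reverse π) (prefix-complement n π τ π·τ↭[n]) 1≤x

lemma1 : ∀ {c ℓ : Level} (R : CommutativeSemiring c ℓ) (θ : CommutativeSemiring.Carrier R)
         (n : ℕ) → 1 ≤ n → (τ π σ : List ℕ) →
         Unique τ → All (λ x → 1 ≤ x × x ≤ n) τ →
         σ ↭ [ n ] → σ ≡ π ++ τ →
         CommutativeSemiring._≈_ R
           (RS._^_ (CommutativeSemiring.rawSemiring R) θ (rec σ))
           (CommutativeSemiring._*_ R
             (RS._^_ (CommutativeSemiring.rawSemiring R) θ (rec π))
             (RS._^_ (CommutativeSemiring.rawSemiring R) θ (recAbove n τ)))
lemma1 R θ n _ τ π σ _ τ⊆[n] σ↭[n] refl
  rewrite rec-++-complement n π τ τ⊆[n] σ↭[n] =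
  ^-homo-* (CommutativeSemiring.semiring R) θ (rec π) (recAbove n τ)
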